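{- Let $Z$ be a finite pseudo-triangulation and let $S=\{(e_1,f_1),\dots,(e_k,f_k)\}$ be a set of pairs of darts of $Z$. Then there exist a pseudo-triangulation $Z^*$ and a homomorphism $\phi^*:Z\to Z^*$ respecting $S$ such that $Z^*$ is a minimal image of $Z$ under $\phi^*$, and such that for every homomorphism $\phi'$ from $Z$ to a pseudo-triangulation $Z'$ that respects $S$ there exists a homomorphism $\phi^{*\prime}:Z^*\to Z'$ with $\phi^{*\prime}\circ\phi^*=\phi'$. Moreover, $\phi^*$ and $Z^*$ are unique up to isomorphism.
   Context: A dart representation consists of a set $V$ of vertices and a set $D$ of darts, each dart $e$ having pointers $\mathrm{head}(e)\in V$, $\mathrm{rev}(e)\in D$, and $\mathrm{succ}(e),\mathrm{pred}(e)\in D\cup\{\mathrm{nil}\}$ (a dart may be its own reverse). It is a pseudo-triangulation if: (M1) every vertex is the head of some dart; (M2) $\mathrm{rev}(\mathrm{rev}(e))=e$; (M3) for darts $e,f$, $e=\mathrm{pred}(f)$ iff $f=\mathrm{succ}(e)$; (M4) if $\mathrm{succ}(e)=f\ne\mathrm{nil}$ then $\mathrm{head}(e)=\mathrm{head}(f)$; (M5) if $\mathrm{succ}(e)\neq\mathrm{nil}$ then there are darts $f=\mathrm{rev}(\mathrm{succ}(e))$, $g=\mathrm{rev}(\mathrm{succ}(f))$ with $e=\mathrm{rev}(\mathrm{succ}(g))$; (M6) for each vertex $v$, the darts with head $v$ form exactly one list under $\mathrm{succ}/\mathrm{pred}$, which is either cyclic or acyclic with $\mathrm{nil}$ at both ends.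 A homomorphism $\phi$ from a dart representation $Z$ to $Z'$ maps vertices to vertices and darts to darts such that for every dart $e$: $\mathrm{head}(\phi(e))=\phi(\mathrm{head}(e))$, $\mathrm{rev}(\phi(e))=\phi(\mathrm{rev}(e))$, and if $\mathrm{succ}(e)\ne\mathrm{nil}$ (resp. $\mathrm{pred}(e)\neq\mathrm{nil}$) then $\mathrm{succ}(\phi(e))=\phi(\mathrm{succ}(e))$ (resp. $\mathrm{pred}(\phi(e))=\phi(\mathrm{pred}(e))$). $Z'$ is a minimal image of $Z$ under $\phi$ if every vertex and dart of $Z'$ is an image under $\phi$, and a dart $e'$ of $Z'$ has non-$\mathrm{nil}$ successor (resp. predecessor) iff some dart $e$ with $\phi(e)=e'$ has non-$\mathrm{nil}$ successor (resp. predecessor). A homomorphism $\phi$ respects $S$ if $\phi(e_i)=\phi(f_i)$ for all $i$. Isomorphism means a bijective homomorphism. -}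

module Defs where

open import Data.Nat using (ℕ; zero; suc)
open import Data.Fin using (Fin)
open import Data.Maybe using (Maybe; just; nothing; _>>=_; Is-just)
open import Data.Product using (Σ; ∃; ∃-syntax; _×_; _,_)
open import Data.Sum using (_⊎_)
open import Data.List using (List)
open import Data.List.Relation.Unary.All using (All)
open import Function.Bundles using (_↔_)
open import Function.Definitions using (Injective)
open import Relation.Binary.PropositionalEquality using (_≡_)

-- A dart representation: vertex set V, dart set D, and the pointers
-- head, rev, succ, pred (nil is represented by 'nothing').
record DartRep : Set₁ where
  field
    V    : Set
    D    : Set
    head : D → V
    rev  : D → D
    succ : D → Maybe D
    pred : D → Maybe D

open DartRep public

iter : {A : Set} → (A → Maybe A) → ℕ → A → Maybe A
iter p zero    e = just e
iter p (suc n) e = iter p n e >>= p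

record IsPseudoTriangulation (Z : DartRep) : Set where
  field
    M1 : ∀ (v : V Z) → ∃[ e ] head Z e ≡ v
    M2 : ∀ (e : D Z) → rev Z (rev Z e) ≡ e
    M3 : ∀ (e f : D Z) → (pred Z f ≡ just e → succ Z e ≡ just f)
                       × (succ Z e ≡ just f → pred Z f ≡ just e)
    M4 : ∀ (e f : D Z) → succ Z e ≡ just f → head Z e ≡ head Z f
    M5 : ∀ (e s : D Z) → succ Z e ≡ just s →
           Σ (D Z) λ t → succ Z (rev Z s) ≡ just t ×
           Σ (D Z) λ u → succ Z (rev Z t) ≡ just u × e ≡ rev Z u
    -- (M6) the darts with a common head form one list under succ/pred:
    -- any two of them are connected by finitely many succ steps (in one of
    -- the two directions), and the list is either cyclic or finite with
    -- nil at both ends.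
    M6-connected : ∀ (e f : D Z) → head Z e ≡ head Z f →
           ∃[ n ] (iter (succ Z) n e ≡ just f ⊎ iter (succ Z) n f ≡ just e)
    M6-ends : ∀ (e : D Z) →
           (∃[ n ] iter (succ Z) (suc n) e ≡ just e)
           ⊎ ((∃[ n ] iter (succ Z) n e ≡ nothing)
              × (∃[ n ] iter (pred Z) n e ≡ nothing))

Finite : DartRep → Set
Finite Z = (∃[ n ] (V Z ↔ Fin n)) × (∃[ m ] (D Z ↔ Fin m))

record Hom (Z Z' : DartRep) : Set where
  field
    onV : V Z → V Z'
    onD : D Z → D Z'
    head-hom : ∀ e → head Z' (onD e) ≡ onV (head Z e)
    rev-hom  : ∀ e → rev Z' (onD e) ≡ onD (rev Z e)
    succ-hom : ∀ e f → succ Z e ≡ just f → succ Z' (onD e) ≡ just (onD f)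
    pred-hom : ∀ e f → pred Z e ≡ just f → pred Z' (onD e) ≡ just (onD f)

open Hom public

Surj : {A B : Set} → (A → B) → Set
Surj {A} {B} f = ∀ (b : B) → ∃[ a ] f a ≡ b

IsMinimalImage : {Z Z' : DartRep} → Hom Z Z' → Set
IsMinimalImage {Z} {Z'} φ =
  Surj (onV φ) × Surj (onD φ)
  × (∀ (e' : D Z') → (Is-just (succ Z' e') → ∃[ e ] (onD φ e ≡ e' × Is-just (succ Z e)))
                   × (∃[ e ] (onD φ e ≡ e' × Is-just (succ Z e)) → Is-just (succ Z' e')))
  × (∀ (e' : D Z') → (Is-just (pred Z' e') → ∃[ e ] (onD φ e ≡ e' × Is-just (pred Z e)))
                   × (∃[ e ] (onD φ e ≡ e' × Is-just (pred Z e)) → Is-just (pred Z' e')))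

Respects : {Z Z' : DartRep} → Hom Z Z' → List (D Z × D Z) → Set
Respects φ S = All (λ { (e , f) → onD φ e ≡ onD φ f }) S

CompEq : {Z Y X : DartRep} → Hom Y X → Hom Z Y → Hom Z X → Set
CompEq {Z} ψ φ χ =
  (∀ (v : V Z) → onV ψ (onV φ v) ≡ onV χ v)
  × (∀ (e : D Z) → onD ψ (onD φ e) ≡ onD χ e)

IsIso : {Z Z' : DartRep} → Hom Z Z' → Set
IsIso φ = (Injective _≡_ _≡_ (onV φ) × Surj (onV φ))
        × (Injective _≡_ _≡_ (onD φ) × Surj (onD φ))

IsUniversalQuotient : (Z : DartRep) → List (D Z × D Z) →
                      (Zs : DartRep) → Hom Z Zs → Set₁
IsUniversalQuotient Z S Zs φs =
  IsPseudoTriangulation Zs × Respects φs S × IsMinimalImage φs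
  × (∀ (Z' : DartRep) → IsPseudoTriangulation Z' → (φ' : Hom Z Z') →
       Respects φ' S → Σ (Hom Zs Z') λ ψ → CompEq ψ φs φ')

-- The quotient merges exactly what every respecting homomorphism into a
-- pseudo-triangulation is forced to merge.  Starting from the discrete partition,
-- darts are merged as long as a pair of S is split or the partition is not
-- compatible with rev, succ and pred (each such merge is forced); then vertices
-- are merged until head is compatible.  Each merge removes a fixed point of the
-- representative map, so this union-find terminates on the finite Z.  Since only
-- forced pairs are merged, every respecting φ′ is constant on classes and factors
-- through Z*.  Compatibility makes the pointers of Z* well defined, so Z* inherits
-- M1–M5 from Z; M6 follows from finiteness and from the invariant that merged
-- vertices have connected dart lists.  Uniqueness is the usual argument for
-- universal objects, using that minimal images are surjective.
module Submission where

open import Defs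
open import Level using (Level)
open import Data.Nat using (ℕ; zero; suc; _+_; _≤_; _<_; z≤n; s≤s)
open import Data.Nat.Properties
  using (m≤n⇒m≤1+n; <-≤-trans; ≤-refl; ≤-pred; ≤-total; +-comm; +-suc; m≤n⇒∃[o]m+o≡n; n<1+n)
open import Data.Fin using (Fin; toℕ)
import Data.Fin as Fin
open import Data.Fin.Properties using (pigeonhole; suc-injective)
open import Data.List using (List; []; _∷_; map; allFin; filter; length)
open import Data.List.Membership.Propositional using (_∈_; lose)
open import Data.List.Membership.Propositional.Properties using (∈-map⁺; ∈-allFin)
open import Data.List.Relation.Unary.All as All using (All; []; _∷_)
open import Data.List.Relation.Unary.Any using (here; there; any?; satisfied)
open import Data.Maybe using (Maybe; just; nothing; _>>=_; Is-just)
open import Data.Maybe.Properties using (just-injective)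
import Data.Maybe.Relation.Unary.Any as Any
open import Data.Product using (Σ; ∃; ∃₂; ∃-syntax; _×_; _,_; proj₁; proj₂; uncurry; swap)
open import Data.Sum as Sum using (_⊎_; inj₁; inj₂)
open import Data.Empty using (⊥-elim)
open import Function using (_on_; id; _∘_)
open import Function.Bundles using (_↔_; Inverse; Injection)
open import Function.Definitions using (Injective)
open import Function.Properties.Inverse using (↔⇒↣)
open import Relation.Nullary using (Dec; yes; no; ¬_)
open import Relation.Nullary.Decidable as Dec using (via-injection)
open import Relation.Binary using (Rel; IsEquivalence; Decidable; DecidableEquality)
open import Relation.Binary.PropositionalEquality hiding ([_])
open import Axiom.UniquenessOfIdentityProofs using (module Decidable⇒UIP)

private variable
  a p w ℓ : Level

infixr 2 _⊎-×_
_⊎-×_ : {W : Set w} {A : Set a} {B : Set p} → W ⊎ A → W ⊎ B → W ⊎ (A × B)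
inj₁ w ⊎-× _      = inj₁ w
inj₂ _ ⊎-× inj₁ w = inj₁ w
inj₂ x ⊎-× inj₂ y = inj₂ (x , y)

all⊎ : {A : Set a} {P : A → Set p} {W : Set w} {xs : List A} →
       All (λ x → W ⊎ P x) xs → W ⊎ All P xs
all⊎ []          = inj₂ []
all⊎ (px ∷ pxs) = Sum.map₂ (uncurry _∷_) (px ⊎-× all⊎ pxs)

record Enumeration (A : Set) : Set where
  field
    elements : List A
    complete : ∀ x → x ∈ elements

  ∃? : {P : A → Set p} → (∀ x → Dec (P x)) → Dec (∃ P)
  ∃? P? = Dec.map′ satisfied (λ (x , px) → lose (complete x) px) (any? P? elements)

  ∀⊎ : {P : A → Set p} {W : Set w} → (∀ x → W ⊎ P x) → W ⊎ (∀ x → P x)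
  ∀⊎ f = Sum.map₂ (λ ps x → All.lookup ps (complete x))
                  (all⊎ (All.tabulate (λ {x} _ → f x)))

  ∀₂⊎ : {P : A → A → Set p} {W : Set w} → (∀ x y → W ⊎ P x y) → W ⊎ (∀ x y → P x y)
  ∀₂⊎ f = ∀⊎ (λ x → ∀⊎ (f x))

module _ {A : Set} {n : ℕ} (A↔Fin : A ↔ Fin n) where
  open Inverse A↔Fin

  ↔Fin⇒≟ : DecidableEquality A
  ↔Fin⇒≟ = via-injection (↔⇒↣ A↔Fin) Fin._≟_

  ↔Fin⇒enumeration : Enumeration A
  ↔Fin⇒enumeration = record
    { elements = map from (allFin n)
    ; complete = λ x → subst (_∈ map from (allFin n)) (strictlyInverseʳ x)
                             (∈-map⁺ from (∈-allFin (to x))) }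

module _ {A : Set} {P Q : A → Set} (P? : ∀ x → Dec (P x)) (Q? : ∀ x → Dec (Q x))
         (P⇒Q : ∀ {x} → P x → Q x) where

  length-filter-mono : ∀ xs → length (filter P? xs) ≤ length (filter Q? xs)
  length-filter-mono [] = z≤n
  length-filter-mono (x ∷ xs) with P? x | Q? x
  ... | yes _  | yes _  = s≤s (length-filter-mono xs)
  ... | yes px | no ¬qx = ⊥-elim (¬qx (P⇒Q px))
  ... | no _   | yes _  = m≤n⇒m≤1+n (length-filter-mono xs)
  ... | no _   | no _   = length-filter-mono xs

  length-filter-strict : ∀ {xs y} → y ∈ xs → Q y → ¬ P y →
                         length (filter P? xs) < length (filter Q? xs)
  length-filter-strict {x ∷ xs} (here refl) qy ¬py with P? x | Q? x
  ... | yes px | _      = ⊥-elim (¬py px)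
  ... | no _   | yes _  = s≤s (length-filter-mono xs)
  ... | no _   | no ¬qy = ⊥-elim (¬qy qy)
  length-filter-strict {x ∷ xs} (there y∈xs) qy ¬py with P? x | Q? x
  ... | yes _  | yes _  = s≤s (length-filter-strict y∈xs qy ¬py)
  ... | yes px | no ¬qx = ⊥-elim (¬qx (P⇒Q px))
  ... | no _   | yes _  = m≤n⇒m≤1+n (length-filter-strict y∈xs qy ¬py)
  ... | no _   | no _   = length-filter-strict y∈xs qy ¬py

infix 4 _=[_]⇀_
_=[_]⇀_ : ∀ {ℓ₁ ℓ₂} {A B : Set} → Rel B ℓ₁ → (B → Maybe A) → Rel A ℓ₂ → Set _
E =[ g ]⇀ F = ∀ {x y x′ y′} → E x y → g x ≡ just x′ → g y ≡ just y′ → F x′ y′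

module Saturation {A : Set} (_≟_ : DecidableEquality A) (enum : Enumeration A)
                  {R : Rel A ℓ} (R-equiv : IsEquivalence R) where
  open Enumeration enum
  module R = IsEquivalence R-equiv

  record Projection (c : A → A) : Set ℓ where
    field
      idempotent : ∀ x → c (c x) ≡ c x
      sound      : ∀ x → R x (c x)

    ≡-on⇒R : ∀ {x y} → c x ≡ c y → R x y
    ≡-on⇒R {x} {y} cx≡cy = R.trans (subst (R x) cx≡cy (sound x)) (R.sym (sound y))

    ≡-on-⇀ : ∀ {B : Set} {f} {F : Rel B f} {g : A → Maybe B} → R =[ g ]⇀ F → (_≡_ on c) =[ g ]⇀ F
    ≡-on-⇀ R⇀F cx≡cy = R⇀F (≡-on⇒R cx≡cy)

  record Violation (c : A → A) : Set ℓ where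
    constructor violation
    field
      {left right} : A
      apart        : c left ≢ c right
      related      : R left right

  fixed-points : (A → A) → ℕ
  fixed-points c = length (filter (λ x → c x ≟ x) elements)

  merge : (A → A) → A → A → A → A
  merge c a b x with c x ≟ c b
  ... | yes _ = c a
  ... | no  _ = c x

  module _ {c : A → A} (proj : Projection c) {a b : A} (ca≢cb : c a ≢ c b) (Rab : R a b) where
    open Projection proj

    merge-projection : Projection (merge c a b)
    merge-projection = record { idempotent = merge-idempotent ; sound = merge-sound }
      where
      merge-c : ∀ x → c x ≢ c b → merge c a b x ≡ c x
      merge-c x cx≢cb with c x ≟ c b
      ... | yes cx≡cb = ⊥-elim (cx≢cb cx≡cb)
      ... | no  _     = refl
      merge-idempotent : ∀ x → merge c a b (merge c a b x) ≡ merge c a b x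
      merge-idempotent x with c x ≟ c b
      ... | yes _    = trans (merge-c (c a) (ca≢cb ∘ trans (sym (idempotent a)))) (idempotent a)
      ... | no cx≢cb = trans (merge-c (c x) (cx≢cb ∘ trans (sym (idempotent x)))) (idempotent x)
      merge-sound : ∀ x → R x (merge c a b x)
      merge-sound x with c x ≟ c b
      ... | yes cx≡cb = R.trans (≡-on⇒R cx≡cb) (R.trans (R.sym Rab) (sound a))
      ... | no  _     = sound x

    merge-fixed-points-< : fixed-points (merge c a b) < fixed-points c
    merge-fixed-points-< =
      length-filter-strict (λ x → merge c a b x ≟ x) (λ x → c x ≟ x) fixed⇒fixed
                           (complete (c b)) (idempotent b) cb-moves
      where
      fixed⇒fixed : ∀ {x} → merge c a b x ≡ x → c x ≡ x
      fixed⇒fixed {x} fx with c x ≟ c b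
      ... | yes cx≡cb = trans (cong c (sym fx)) (trans (idempotent a) fx)
      ... | no  _     = fx
      cb-moves : merge c a b (c b) ≢ c b
      cb-moves with c (c b) ≟ c b
      ... | yes _     = ca≢cb
      ... | no  ¬idem = λ _ → ¬idem (idempotent b)

  saturate : ∀ {g} (Closed : (A → A) → Set g) → (∀ c → Projection c → Violation c ⊎ Closed c) →
             Σ (A → A) λ c → Projection c × Closed c
  saturate Closed step = go (suc (fixed-points id)) id id-projection ≤-refl
    where
    id-projection : Projection id
    id-projection = record { idempotent = λ _ → refl ; sound = λ _ → R.refl }
    go : (fuel : ℕ) (c : A → A) → Projection c → fixed-points c < fuel →
         Σ (A → A) λ c → Projection c × Closed c
    go (suc fuel) c proj fp<fuel with step c proj
    ... | inj₂ closed = c , proj , closed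
    ... | inj₁ (violation ca≢cb Rab) =
      go fuel (merge c _ _) (merge-projection proj ca≢cb Rab)
         (<-≤-trans (merge-fixed-points-< proj ca≢cb Rab) (≤-pred fp<fuel))

  violation⊎compatible : ∀ {B : Set} {e} {E : Rel B e} → Enumeration B → Decidable E →
                         (g : B → Maybe A) → E =[ g ]⇀ R →
                         ∀ c → Violation c ⊎ E =[ g ]⇀ (_≡_ on c)
  violation⊎compatible {B = B} {E = E} B-enum E? g E⇀R c =
    Sum.map₂ (λ compatible {x} {y} → compatible x y) (Enumeration.∀₂⊎ B-enum {P = Compatible} test)
    where
    Compatible : B → B → Set _
    Compatible x y = ∀ {x′ y′} → E x y → g x ≡ just x′ → g y ≡ just y′ → c x′ ≡ c y′
    test : ∀ x y → Violation c ⊎ Compatible x y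
    test x y with E? x y | g x in gx | g y in gy
    ... | no ¬exy | _       | _       = inj₂ λ exy → ⊥-elim (¬exy exy)
    ... | yes _   | nothing | _       = inj₂ λ _ ()
    ... | yes _   | just _  | nothing = inj₂ λ _ _ ()
    ... | yes exy | just x′ | just y′ with c x′ ≟ c y′
    ...   | yes cx′≡cy′ = inj₂ λ { _ refl refl → cx′≡cy′ }
    ...   | no  cx′≢cy′ = inj₁ (violation cx′≢cy′ (E⇀R exy gx gy))

module Iteration {B : Set} (f : B → Maybe B) where

  iter-suc⁻ : ∀ n {a c} → iter f (suc n) a ≡ just c → ∃[ b ] iter f n a ≡ just b × f b ≡ just c
  iter-suc⁻ n {a} a→c with iter f n a
  ... | just b = b , refl , a→c

  iter-+ : ∀ j {n a b} → iter f n a ≡ just b → iter f (j + n) a ≡ iter f j b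
  iter-+ zero    a→b = a→b
  iter-+ (suc j) a→b = cong (_>>= f) (iter-+ j a→b)

  Connected : B → B → Set
  Connected a b = ∃[ n ] (iter f n a ≡ just b ⊎ iter f n b ≡ just a)

  ≡⇒Connected : ∀ {a b} → a ≡ b → Connected a b
  ≡⇒Connected a≡b = 0 , inj₁ (cong just a≡b)

  Connected-sym : ∀ {a b} → Connected a b → Connected b a
  Connected-sym (n , inj₁ a→b) = n , inj₂ a→b
  Connected-sym (n , inj₂ b→a) = n , inj₁ b→a

  common-source⇒Connected : ∀ n k {a b b′} → iter f n a ≡ just b → iter f k a ≡ just b′ →
                            Connected b b′
  common-source⇒Connected n k {a} {b} {b′} a→b a→b′ with ≤-total n k
  ... | inj₁ n≤k with o , refl ← m≤n⇒∃[o]m+o≡n n≤k =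
    o , inj₁ (trans (sym (iter-+ o a→b)) (subst (λ i → iter f i a ≡ just b′) (+-comm n o) a→b′))
  ... | inj₂ k≤n with o , refl ← m≤n⇒∃[o]m+o≡n k≤n =
    o , inj₂ (trans (sym (iter-+ o a→b′)) (subst (λ i → iter f i a ≡ just b) (+-comm k o) a→b))

  module _ (f-injective : ∀ {a a′ b} → f a ≡ just b → f a′ ≡ just b → a ≡ a′) where

    common-target⇒Connected : ∀ n k {a a′ b} → iter f n a ≡ just b → iter f k a′ ≡ just b →
                              Connected a a′
    common-target⇒Connected zero    k       refl a′→b = k , inj₂ a′→b
    common-target⇒Connected (suc n) zero    a→b  refl = suc n , inj₁ a→b
    common-target⇒Connected (suc n) (suc k) a→b  a′→b
      with c , a→c , fc≡b ← iter-suc⁻ n a→b | c′ , a′→c′ , fc′≡b ← iter-suc⁻ k a′→b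
      with refl ← f-injective fc≡b fc′≡b = common-target⇒Connected n k a→c a′→c′

    Connected-trans : ∀ {a b c} → Connected a b → Connected b c → Connected a c
    Connected-trans (n , inj₁ a→b) (k , inj₁ b→c) = k + n , inj₁ (trans (iter-+ k a→b) b→c)
    Connected-trans (n , inj₁ a→b) (k , inj₂ c→b) = common-target⇒Connected n k a→b c→b
    Connected-trans (n , inj₂ b→a) (k , inj₁ b→c) = common-source⇒Connected n k b→a b→c
    Connected-trans (n , inj₂ b→a) (k , inj₂ c→b) = n + k , inj₂ (trans (iter-+ n c→b) b→a)

    iter-cancel : ∀ i {n a b} → iter f i a ≡ just b → iter f (i + n) a ≡ just b →
                  iter f n a ≡ just a
    iter-cancel zero    refl a→a = a→a
    iter-cancel (suc i) {n} a→b a→b′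
      with c , a→c , fc≡b ← iter-suc⁻ i a→b | c′ , a→c′ , fc′≡b ← iter-suc⁻ (i + n) a→b′
      with refl ← f-injective fc≡b fc′≡b = iter-cancel i a→c a→c′

    module _ {m} {toFin : B → Fin m} (toFin-injective : Injective _≡_ _≡_ toFin) where

      -- Ends are coded by zero, so two of the first m + 2 iterates share a code:
      -- either both are ends, or the orbit repeats and, f being injective, returns to a.
      private
        code : Maybe B → Fin (suc m)
        code nothing  = Fin.zero
        code (just b) = Fin.suc (toFin b)

        code-injective : Injective _≡_ _≡_ code
        code-injective {nothing} {nothing} _  = refl
        code-injective {just _}  {just _}  eq = cong just (toFin-injective (suc-injective eq))

      cycle⊎end : ∀ a → (∃[ n ] iter f (suc n) a ≡ just a) ⊎ (∃[ n ] iter f n a ≡ nothing)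
      cycle⊎end a
        with i , j , i<j , same-code ← pigeonhole (n<1+n (suc m)) (λ i → code (iter f (toℕ i) a))
        with o , i+1+o≡j ← m≤n⇒∃[o]m+o≡n i<j
        with iter f (toℕ i) a in a→i | code-injective same-code
      ... | nothing | _   = inj₂ (toℕ i , a→i)
      ... | just b  | a→j = inj₁ (o , iter-cancel (toℕ i) a→i a→b)
        where
        a→b : iter f (toℕ i + suc o) a ≡ just b
        a→b = subst (λ k → iter f k a ≡ just b) (sym (trans (+-suc (toℕ i) o) i+1+o≡j)) (sym a→j)

iter-reverse : {B : Set} {f g : B → Maybe B} → (∀ {a b} → g a ≡ just b → f b ≡ just a) →
               ∀ n {a b} → iter g n a ≡ just b → iter f n b ≡ just a
iter-reverse g⇒f zero    refl = refl
iter-reverse {f = f} {g} g⇒f (suc n) {a} {b} a→b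
  with c , a→c , gc≡b ← Iteration.iter-suc⁻ g n a→b =
  subst (λ k → iter f k b ≡ just a) (+-comm n 1)
        (trans (Iteration.iter-+ f n (g⇒f gc≡b)) (iter-reverse g⇒f n a→c))

MutuallyInverse : {A : Set} → (A → Maybe A) → (A → Maybe A) → Set
MutuallyInverse s p = ∀ e f → (p f ≡ just e → s e ≡ just f) × (s e ≡ just f → p f ≡ just e)

module _ {A : Set} where

  MutuallyInverse-sym : {s p : A → Maybe A} → MutuallyInverse s p → MutuallyInverse p s
  MutuallyInverse-sym s⇄p e f = swap (s⇄p f e)

  MutuallyInverse⇒injective : {s p : A → Maybe A} → MutuallyInverse s p →
                              ∀ {a a′ b} → s a ≡ just b → s a′ ≡ just b → a ≡ a′
  MutuallyInverse⇒injective s⇄p sa≡b sa′≡b =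
    just-injective (trans (sym (proj₂ (s⇄p _ _) sa≡b)) (proj₂ (s⇄p _ _) sa′≡b))

  cycle⊎ends : {s p : A → Maybe A} → MutuallyInverse s p →
               ∀ {m} {toFin : A → Fin m} → Injective _≡_ _≡_ toFin → ∀ a →
               (∃[ n ] iter s (suc n) a ≡ just a)
               ⊎ ((∃[ n ] iter s n a ≡ nothing) × (∃[ n ] iter p n a ≡ nothing))
  cycle⊎ends {s} {p} s⇄p toFin-injective a
    with Iteration.cycle⊎end s s-injective toFin-injective a
       | Iteration.cycle⊎end p p-injective toFin-injective a
    where
    s-injective = MutuallyInverse⇒injective s⇄p
    p-injective = MutuallyInverse⇒injective (MutuallyInverse-sym s⇄p)
  ... | inj₁ s-cycle | _                  = inj₁ s-cycle
  ... | inj₂ s-end   | inj₂ p-end         = inj₂ (s-end , p-end)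
  ... | inj₂ _       | inj₁ (n , p-cycle) =
    inj₁ (n , iter-reverse (λ {a} {b} → proj₁ (s⇄p b a)) (suc n) p-cycle)

module _ {A B : Set} {f : A → Maybe A} {g : B → Maybe B} (h : A → B)
         (h-hom : ∀ {a a′} → f a ≡ just a′ → g (h a) ≡ just (h a′)) where

  iter-map : ∀ n {a a′} → iter f n a ≡ just a′ → iter g n (h a) ≡ just (h a′)
  iter-map zero    refl = refl
  iter-map (suc n) a→a′ with b , a→b , fb≡a′ ← Iteration.iter-suc⁻ f n a→a′
    rewrite iter-map n a→b = h-hom fb≡a′

  Connected-map : ∀ {a b} → Iteration.Connected f a b → Iteration.Connected g (h a) (h b)
  Connected-map (n , a→b⊎b→a) = n , Sum.map (iter-map n) (iter-map n) a→b⊎b→a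

Is-just⇒≡just : {A : Set} {m : Maybe A} → Is-just m → ∃ λ x → m ≡ just x
Is-just⇒≡just (Any.just _) = _ , refl

≡just⇒Is-just : {A : Set} {m : Maybe A} {x : A} → m ≡ just x → Is-just m
≡just⇒Is-just refl = Any.just _

record IsCongruence (Z : DartRep) (c : D Z → D Z) : Set where
  field
    rev-compatible  : (_≡_ on c) =[ just ∘ rev Z ]⇀ (_≡_ on c)
    succ-compatible : (_≡_ on c) =[ succ Z ]⇀ (_≡_ on c)
    pred-compatible : (_≡_ on c) =[ pred Z ]⇀ (_≡_ on c)

-- A quotient is represented by the fixed points of an idempotent map picking
-- canonical representatives; decidable equality makes the fixed-point proofs unique.
module FixedPoints {A : Set} (_≟_ : DecidableEquality A)
                   (c : A → A) (c-idempotent : ∀ x → c (c x) ≡ c x) where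

  Fix : Set
  Fix = Σ A λ x → c x ≡ x

  [_] : A → Fix
  [ x ] = c x , c-idempotent x

  Fix-≡ : {a b : Fix} → proj₁ a ≡ proj₁ b → a ≡ b
  Fix-≡ {x , p} {.x , q} refl = cong (x ,_) (Decidable⇒UIP.≡-irrelevant _≟_ p q)

module Quotient (Z : DartRep) (Z-pt : IsPseudoTriangulation Z) {m} (D↔Fin : D Z ↔ Fin m)
                (c : D Z → D Z) (c-idempotent : ∀ x → c (c x) ≡ c x)
                (c-congruence : IsCongruence Z c) where
  open IsPseudoTriangulation Z-pt
  open IsCongruence c-congruence
  open Enumeration (↔Fin⇒enumeration D↔Fin) using (∃?)
  open FixedPoints (↔Fin⇒≟ D↔Fin) c c-idempotent public renaming (Fix to D*; Fix-≡ to D*-≡)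

  module Induced (g : D Z → Maybe (D Z)) (g-compatible : (_≡_ on c) =[ g ]⇀ (_≡_ on c)) where

    Image : D* → Set
    Image a = ∃₂ λ y z → c y ≡ proj₁ a × g y ≡ just z

    image? : ∀ a → Dec (Image a)
    image? a = ∃? λ y → has-image? y
      where
      has-image? : ∀ y → Dec (∃[ z ] c y ≡ proj₁ a × g y ≡ just z)
      has-image? y with ↔Fin⇒≟ D↔Fin (c y) (proj₁ a) | g y
      ... | no cy≢a  | _       = no λ (_ , cy≡a , _) → cy≢a cy≡a
      ... | yes _    | nothing = no λ ()
      ... | yes cy≡a | just z  = yes (z , cy≡a , refl)

    -- A representative may lack a g-image that another member of its class has,
    -- so the whole class is searched.
    induced : D* → Maybe D*
    induced a with image? a
    ... | yes (_ , z , _) = just [ z ]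
    ... | no  _           = nothing

    induced-[] : ∀ {y z} → g y ≡ just z → induced [ y ] ≡ just [ z ]
    induced-[] {y} {z} gy≡z with image? [ y ]
    ... | yes (_ , z′ , cy′≡cy , gy′≡z′) = cong just (D*-≡ (g-compatible cy′≡cy gy′≡z′ gy≡z))
    ... | no  no-image                   = ⊥-elim (no-image (y , z , refl , gy≡z))

    induced⁻ : ∀ {a b} → induced a ≡ just b → ∃₂ λ y z → [ y ] ≡ a × g y ≡ just z × [ z ] ≡ b
    induced⁻ {a} a↦b with image? a
    ... | yes (y , z , cy≡a , gy≡z) = y , z , D*-≡ cy≡a , gy≡z , just-injective a↦b

    induced-Is-just⇔ : ∀ a → (Is-just (induced a) → ∃[ y ] [ y ] ≡ a × Is-just (g y))
                           × (∃[ y ] [ y ] ≡ a × Is-just (g y) → Is-just (induced a))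
    induced-Is-just⇔ a = defined⁻ , defined
      where
      defined⁻ : Is-just (induced a) → ∃[ y ] [ y ] ≡ a × Is-just (g y)
      defined⁻ a↦
        with _ , a↦b ← Is-just⇒≡just a↦
        with y , _ , [y]≡a , gy≡z , _ ← induced⁻ a↦b = y , [y]≡a , ≡just⇒Is-just gy≡z
      defined : ∃[ y ] [ y ] ≡ a × Is-just (g y) → Is-just (induced a)
      defined (y , refl , y↦) with _ , gy≡z ← Is-just⇒≡just y↦ = ≡just⇒Is-just (induced-[] gy≡z)

  rev* : D* → D*
  rev* a = [ rev Z (proj₁ a) ]

  open Induced (succ Z) succ-compatible public
    using () renaming (induced to succ*; induced-[] to succ*-[]; induced⁻ to succ*⁻;
              induced-Is-just⇔ to succ*-Is-just⇔)
  open Induced (pred Z) pred-compatible public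
    using () renaming (induced to pred*; induced-[] to pred*-[]; induced⁻ to pred*⁻;
              induced-Is-just⇔ to pred*-Is-just⇔)

  rev*-[] : ∀ x → rev* [ x ] ≡ [ rev Z x ]
  rev*-[] x = D*-≡ (rev-compatible (c-idempotent x) refl refl)

  succ*⇄pred* : MutuallyInverse succ* pred*
  succ*⇄pred* _ _ = pred→succ , succ→pred
    where
    pred→succ : ∀ {e f} → pred* f ≡ just e → succ* e ≡ just f
    pred→succ f↦e with y , z , refl , pred-y≡z , refl ← pred*⁻ f↦e =
      succ*-[] (proj₁ (M3 z y) pred-y≡z)
    succ→pred : ∀ {e f} → succ* e ≡ just f → pred* f ≡ just e
    succ→pred e↦f with y , z , refl , succ-y≡z , refl ← succ*⁻ e↦f =
      pred*-[] (proj₂ (M3 y z) succ-y≡z)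

  open Iteration succ* public using (Connected; Connected-sym; ≡⇒Connected)

  Connected-trans : ∀ {a b d} → Connected a b → Connected b d → Connected a d
  Connected-trans = Iteration.Connected-trans succ* (MutuallyInverse⇒injective succ*⇄pred*)

  cohead⇒Connected : ∀ {x y} → head Z x ≡ head Z y → Connected [ x ] [ y ]
  cohead⇒Connected {x} {y} hx≡hy = Connected-map [_] succ*-[] (M6-connected x y hx≡hy)

  module VertexQuotient {n} (V↔Fin : V Z ↔ Fin n)
           (cv : V Z → V Z) (cv-idempotent : ∀ v → cv (cv v) ≡ cv v)
           (head-compatible : (_≡_ on c) =[ just ∘ head Z ]⇀ (_≡_ on cv))
           (cv-connected : ∀ {x y} → cv (head Z x) ≡ cv (head Z y) → Connected [ x ] [ y ]) where
    open FixedPoints (↔Fin⇒≟ V↔Fin) cv cv-idempotent public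
      renaming (Fix to V*; [_] to [_]ⱽ; Fix-≡ to V*-≡)

    head* : D* → V*
    head* a = [ head Z (proj₁ a) ]ⱽ

    head*-[] : ∀ x → head* [ x ] ≡ [ head Z x ]ⱽ
    head*-[] x = V*-≡ (head-compatible (c-idempotent x) refl refl)

    Z* : DartRep
    Z* = record { V = V* ; D = D* ; head = head* ; rev = rev* ; succ = succ* ; pred = pred* }

    φ* : Hom Z Z*
    φ* = record
      { onV = [_]ⱽ ; onD = [_] ; head-hom = head*-[] ; rev-hom = rev*-[]
      ; succ-hom = λ _ _ → succ*-[] ; pred-hom = λ _ _ → pred*-[] }

    φ*-minimal : IsMinimalImage φ*
    φ*-minimal = (λ (v , cv≡v) → v , V*-≡ cv≡v) , (λ (x , cx≡x) → x , D*-≡ cx≡x)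
               , succ*-Is-just⇔ , pred*-Is-just⇔

    Z*-pseudoTriangulation : IsPseudoTriangulation Z*
    Z*-pseudoTriangulation = record
      { M1 = M1* ; M2 = M2* ; M3 = succ*⇄pred* ; M4 = M4* ; M5 = M5*
      ; M6-connected = M6-connected*
      ; M6-ends = cycle⊎ends succ*⇄pred* (D*-≡ ∘ Injection.injective (↔⇒↣ D↔Fin)) }
      where
      M1* : ∀ a → ∃[ e ] head* e ≡ a
      M1* (v , cv≡v) with x , head-x≡v ← M1 v =
        [ x ] , trans (head*-[] x) (V*-≡ (trans (cong cv head-x≡v) cv≡v))
      M2* : ∀ a → rev* (rev* a) ≡ a
      M2* (x , cx≡x) = begin
        rev* [ rev Z x ]    ≡⟨ rev*-[] (rev Z x) ⟩
        [ rev Z (rev Z x) ] ≡⟨ cong [_] (M2 x) ⟩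
        [ x ]               ≡⟨ D*-≡ cx≡x ⟩
        (x , cx≡x)          ∎
        where open ≡-Reasoning
      M4* : ∀ a b → succ* a ≡ just b → head* a ≡ head* b
      M4* _ _ a↦b with y , z , refl , succ-y≡z , refl ← succ*⁻ a↦b =
        trans (head*-[] y) (trans (cong [_]ⱽ (M4 y z succ-y≡z)) (sym (head*-[] z)))
      M5* : ∀ e s → succ* e ≡ just s →
            Σ D* λ t → succ* (rev* s) ≡ just t × Σ D* λ u → succ* (rev* t) ≡ just u × e ≡ rev* u
      M5* _ _ e↦s with y , z , refl , succ-y≡z , refl ← succ*⁻ e↦s
                  with t , succ-rev-z≡t , u , succ-rev-t≡u , y≡rev-u ← M5 y z succ-y≡z =
        [ t ] , trans (cong succ* (rev*-[] z)) (succ*-[] succ-rev-z≡t) ,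
        [ u ] , trans (cong succ* (rev*-[] t)) (succ*-[] succ-rev-t≡u) ,
        trans (cong [_] y≡rev-u) (sym (rev*-[] u))
      M6-connected* : ∀ a b → head* a ≡ head* b → Connected a b
      M6-connected* (x , cx≡x) (y , cy≡y) head*≡ =
        subst₂ Connected (D*-≡ cx≡x) (D*-≡ cy≡y) (cv-connected (cong proj₁ head*≡))

    factor : ∀ {Z′} (φ : Hom Z Z′) →
             (∀ v → onV φ (cv v) ≡ onV φ v) → (∀ x → onD φ (c x) ≡ onD φ x) →
             Σ (Hom Z* Z′) λ ψ → CompEq ψ φ* φ
    factor {Z′} φ φ-cv φ-c = ψ , φ-cv , φ-c
      where
      lift : ∀ {g* : D* → Maybe D*} {g : D Z → Maybe (D Z)} {g′ : D Z′ → Maybe (D Z′)} →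
             (∀ {a b} → g* a ≡ just b → ∃₂ λ y z → [ y ] ≡ a × g y ≡ just z × [ z ] ≡ b) →
             (∀ x y → g x ≡ just y → g′ (onD φ x) ≡ just (onD φ y)) →
             ∀ a b → g* a ≡ just b → g′ (onD φ (proj₁ a)) ≡ just (onD φ (proj₁ b))
      lift g*⁻ g-hom _ _ a↦b with y , z , refl , gy≡z , refl ← g*⁻ a↦b
        rewrite φ-c y | φ-c z = g-hom y z gy≡z
      ψ : Hom Z* Z′
      ψ = record
        { onV = onV φ ∘ proj₁ ; onD = onD φ ∘ proj₁
        ; head-hom = λ a → trans (head-hom φ (proj₁ a)) (sym (φ-cv _))
        ; rev-hom = λ a → trans (rev-hom φ (proj₁ a)) (sym (φ-c _))
        ; succ-hom = lift {g′ = succ Z′} succ*⁻ (succ-hom φ)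
        ; pred-hom = lift {g′ = pred Z′} pred*⁻ (pred-hom φ) }

module UniversalQuotient (Z : DartRep) (Z-pt : IsPseudoTriangulation Z) (Z-finite : Finite Z)
                         (S : List (D Z × D Z)) where
  open IsPseudoTriangulation Z-pt
  private
    D↔Fin = proj₂ (proj₂ Z-finite)
    V↔Fin = proj₂ (proj₁ Z-finite)
    D-enum = ↔Fin⇒enumeration D↔Fin
    _≟ᴰ_ = ↔Fin⇒≟ D↔Fin

  Forced : (∀ {Z′} → Hom Z Z′ → Set) → Set₁
  Forced P = ∀ Z′ → IsPseudoTriangulation Z′ → (φ : Hom Z Z′) → Respects φ S → P φ

  _≈ᴰ_ : Rel (D Z) _
  x ≈ᴰ y = Forced λ φ → onD φ x ≡ onD φ y

  ≈ᴰ-isEquivalence : IsEquivalence _≈ᴰ_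
  ≈ᴰ-isEquivalence = record
    { refl  = λ _ _ _ _ → refl
    ; sym   = λ x≈y Z′ pt φ r → sym (x≈y Z′ pt φ r)
    ; trans = λ x≈y y≈z Z′ pt φ r → trans (x≈y Z′ pt φ r) (y≈z Z′ pt φ r) }

  ≈ᴰ-transport : {g : D Z → Maybe (D Z)} (g′ : ∀ Z′ → D Z′ → Maybe (D Z′)) →
                 (∀ {Z′} (φ : Hom Z Z′) {x y} → g x ≡ just y → g′ Z′ (onD φ x) ≡ just (onD φ y)) →
                 _≈ᴰ_ =[ g ]⇀ _≈ᴰ_
  ≈ᴰ-transport g′ g-hom x≈y gx≡x′ gy≡y′ Z′ pt φ r = just-injective (begin
    just _               ≡⟨ g-hom φ gx≡x′ ⟨
    g′ Z′ (onD φ _)      ≡⟨ cong (g′ Z′) (x≈y Z′ pt φ r) ⟩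
    g′ Z′ (onD φ _)      ≡⟨ g-hom φ gy≡y′ ⟩
    just _               ∎)
    where open ≡-Reasoning

  module DartSaturation = Saturation _≟ᴰ_ D-enum ≈ᴰ-isEquivalence
  open DartSaturation using (Projection; Violation; violation; violation⊎compatible)

  Admissible : (D Z → D Z) → Set
  Admissible c = IsCongruence Z c × All (λ p → c (proj₁ p) ≡ c (proj₂ p)) S

  dart-step : ∀ c → Projection c → Violation c ⊎ Admissible c
  dart-step c proj
    with violation⊎compatible D-enum (λ x y → c x ≟ᴰ c y) (just ∘ rev Z) (≡-on-⇀ ≈ᴰ-rev) c
     ⊎-× violation⊎compatible D-enum (λ x y → c x ≟ᴰ c y) (succ Z) (≡-on-⇀ ≈ᴰ-succ) c
     ⊎-× violation⊎compatible D-enum (λ x y → c x ≟ᴰ c y) (pred Z) (≡-on-⇀ ≈ᴰ-pred) c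
     ⊎-× all⊎ (All.tabulate pair-merged?)
    where
    open Projection proj using (≡-on-⇀)
    ≈ᴰ-rev : _≈ᴰ_ =[ just ∘ rev Z ]⇀ _≈ᴰ_
    ≈ᴰ-rev = ≈ᴰ-transport (λ Z′ → just ∘ rev Z′) λ { φ refl → cong just (rev-hom φ _) }
    ≈ᴰ-succ : _≈ᴰ_ =[ succ Z ]⇀ _≈ᴰ_
    ≈ᴰ-succ = ≈ᴰ-transport succ λ φ → succ-hom φ _ _
    ≈ᴰ-pred : _≈ᴰ_ =[ pred Z ]⇀ _≈ᴰ_
    ≈ᴰ-pred = ≈ᴰ-transport pred λ φ → pred-hom φ _ _
    pair-merged? : ∀ {p} → p ∈ S → Violation c ⊎ c (proj₁ p) ≡ c (proj₂ p)
    pair-merged? {e , f} p∈S with c e ≟ᴰ c f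
    ... | yes ce≡cf = inj₂ ce≡cf
    ... | no  ce≢cf = inj₁ (violation ce≢cf λ _ _ _ φ-respects → All.lookup φ-respects p∈S)
  ... | inj₁ v = inj₁ v
  ... | inj₂ (rev-c , succ-c , pred-c , S-c) =
    inj₂ ( record { rev-compatible = rev-c ; succ-compatible = succ-c ; pred-compatible = pred-c }
         , S-c )

  c-saturated : Σ (D Z → D Z) λ c → Projection c × Admissible c
  c-saturated = DartSaturation.saturate Admissible dart-step

  c : D Z → D Z
  c = proj₁ c-saturated

  c-projection : Projection c
  c-projection = proj₁ (proj₂ c-saturated)

  c-admissible : Admissible c
  c-admissible = proj₂ (proj₂ c-saturated)

  open Projection c-projection using () renaming (≡-on⇒R to ≡-on-c⇒≈ᴰ)

  open Quotient Z Z-pt D↔Fin c (Projection.idempotent c-projection) (proj₁ c-admissible)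

  -- Vertices are only merged when their darts are connected in the quotient, the
  -- invariant from which M6-connected follows for Z*.
  _≈ⱽ_ : Rel (V Z) _
  v ≈ⱽ w = (∀ {x y} → head Z x ≡ v → head Z y ≡ w → Connected [ x ] [ y ])
         × Forced (λ φ → onV φ v ≡ onV φ w)

  ≈ⱽ-isEquivalence : IsEquivalence _≈ⱽ_
  ≈ⱽ-isEquivalence = record
    { refl  = (λ hx hy → cohead⇒Connected (trans hx (sym hy))) , λ _ _ _ _ → refl
    ; sym   = λ (conn , forced) → (λ hx hy → Connected-sym (conn hy hx))
                                 , λ Z′ pt φ r → sym (forced Z′ pt φ r)
    ; trans = λ {_} {v} (conn , forced) (conn′ , forced′) →
                let x , hx≡v = M1 v in
                (λ hy hz → Connected-trans (conn hy hx≡v) (conn′ hx≡v hz))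
              , λ Z′ pt φ r → trans (forced Z′ pt φ r) (forced′ Z′ pt φ r) }

  module VertexSaturation = Saturation (↔Fin⇒≟ V↔Fin) (↔Fin⇒enumeration V↔Fin) ≈ⱽ-isEquivalence

  head-≈ⱽ : (_≡_ on c) =[ just ∘ head Z ]⇀ _≈ⱽ_
  head-≈ⱽ {x} {y} cx≡cy refl refl = connected , forced
    where
    connected : ∀ {x′ y′} → head Z x′ ≡ head Z x → head Z y′ ≡ head Z y → Connected [ x′ ] [ y′ ]
    connected hx′ hy′ = Connected-trans (cohead⇒Connected hx′)
                          (Connected-trans (≡⇒Connected (D*-≡ cx≡cy)) (cohead⇒Connected (sym hy′)))
    forced : Forced λ φ → onV φ (head Z x) ≡ onV φ (head Z y)
    forced Z′ pt φ r = begin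
      onV φ (head Z x)    ≡⟨ head-hom φ x ⟨
      head Z′ (onD φ x)   ≡⟨ cong (head Z′) (≡-on-c⇒≈ᴰ cx≡cy Z′ pt φ r) ⟩
      head Z′ (onD φ y)   ≡⟨ head-hom φ y ⟩
      onV φ (head Z y)    ∎
      where open ≡-Reasoning

  cv-saturated : Σ (V Z → V Z) λ cv →
                 VertexSaturation.Projection cv × (_≡_ on c) =[ just ∘ head Z ]⇀ (_≡_ on cv)
  cv-saturated = VertexSaturation.saturate _ λ cv _ →
    VertexSaturation.violation⊎compatible D-enum (λ x y → c x ≟ᴰ c y) (just ∘ head Z) head-≈ⱽ cv

  cv : V Z → V Z
  cv = proj₁ cv-saturated

  cv-projection : VertexSaturation.Projection cv
  cv-projection = proj₁ (proj₂ cv-saturated)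

  cv-connected : ∀ {x y} → cv (head Z x) ≡ cv (head Z y) → Connected [ x ] [ y ]
  cv-connected cv≡cv = proj₁ (VertexSaturation.Projection.≡-on⇒R cv-projection cv≡cv) refl refl

  open VertexQuotient V↔Fin cv (VertexSaturation.Projection.idempotent cv-projection)
                      (proj₂ (proj₂ cv-saturated)) cv-connected public

  φ*-respects : Respects φ* S
  φ*-respects = All.map (λ {(e , f)} → D*-≡) (proj₂ c-admissible)

  φ*-universal : IsUniversalQuotient Z S Z* φ*
  φ*-universal = Z*-pseudoTriangulation , φ*-respects , φ*-minimal , λ Z′ pt φ r →
    factor φ (λ v → sym (proj₂ (VertexSaturation.Projection.sound cv-projection v) Z′ pt φ r))
             (λ x → sym (Projection.sound c-projection x Z′ pt φ r))

module _ {A B C : Set} {f : A → B} {g : A → C} {h : B → C} {k : C → B} where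

  factor-bijective : Surj f → Surj g → (∀ a → h (f a) ≡ g a) → (∀ a → k (g a) ≡ f a) →
                     Injective _≡_ _≡_ h × Surj h
  factor-bijective f-surj g-surj hf≡g kg≡f = h-injective , h-surjective
    where
    kh≡id : ∀ b → k (h b) ≡ b
    kh≡id b with a , refl ← f-surj b = trans (cong k (hf≡g a)) (kg≡f a)
    h-injective : Injective _≡_ _≡_ h
    h-injective {b} {b′} hb≡hb′ = trans (sym (kh≡id b)) (trans (cong k hb≡hb′) (kh≡id b′))
    h-surjective : Surj h
    h-surjective c with a , refl ← g-surj c = f a , hf≡g a

IsUniversalQuotient-unique : ∀ {Z S Z₁ Z₂} {φ₁ : Hom Z Z₁} {φ₂ : Hom Z Z₂} →
  IsUniversalQuotient Z S Z₁ φ₁ → IsUniversalQuotient Z S Z₂ φ₂ →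
  Σ (Hom Z₁ Z₂) λ ψ → IsIso ψ × CompEq ψ φ₁ φ₂
IsUniversalQuotient-unique {Z₁ = Z₁} {Z₂} {φ₁} {φ₂}
  (Z₁-pt , φ₁-respects , (φ₁-surjᵛ , φ₁-surjᴰ , _) , φ₁-universal)
  (Z₂-pt , φ₂-respects , (φ₂-surjᵛ , φ₂-surjᴰ , _) , φ₂-universal)
  with ψ , ψφ₁≡φ₂ᵛ , ψφ₁≡φ₂ᴰ ← φ₁-universal Z₂ Z₂-pt φ₂ φ₂-respects
     | χ , χφ₂≡φ₁ᵛ , χφ₂≡φ₁ᴰ ← φ₂-universal Z₁ Z₁-pt φ₁ φ₁-respects =
  ψ , ( factor-bijective {k = onV χ} φ₁-surjᵛ φ₂-surjᵛ ψφ₁≡φ₂ᵛ χφ₂≡φ₁ᵛ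
      , factor-bijective {k = onD χ} φ₁-surjᴰ φ₂-surjᴰ ψφ₁≡φ₂ᴰ χφ₂≡φ₁ᴰ )
    , ψφ₁≡φ₂ᵛ , ψφ₁≡φ₂ᴰ

lemma9p7 : (Z : DartRep) → IsPseudoTriangulation Z → Finite Z →
    (S : List (D Z × D Z)) →
    Σ DartRep (λ Zs → Σ (Hom Z Zs) (λ φs →
      IsUniversalQuotient Z S Zs φs
      × ((Zt : DartRep) → (φt : Hom Z Zt) → IsUniversalQuotient Z S Zt φt →
          Σ (Hom Zs Zt) (λ ψ → IsIso ψ × CompEq ψ φs φt))))
lemma9p7 Z Z-pt Z-finite S =
  Z* , φ* , φ*-universal ,
  λ _ φt → IsUniversalQuotient-unique {S = S} {φ₁ = φ*} {φ₂ = φt} φ*-universal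
  where open UniversalQuotient Z Z-pt Z-finite S
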